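{- Let $2\le k\le n-1$ and consider the circulant digraph $C_n(\{1,k\})$ with vertex set $\{v_0,\dots,v_{n-1}\}$. If $n\ge (k-1)\lceil n/k\rceil$, then for every $0\le i\le n-1$, $d(v_0,v_i)=\lfloor i/k\rfloor + re(i,k)$. Moreover, $\mathrm{diam}(C_n(\{1,k\})) = \lfloor (n-1)/k\rfloor + \max\{re(n-1,k),\, k-2\}$.
   Context: For an integer $n\ge 2$ and $S\subseteq\{1,\dots,n-1\}$, the circulant digraph $C_n(S)$ has vertex set $\{v_0,\dots,v_{n-1}\}$ and arcs $v_iv_j$ whenever $j-i\equiv s \pmod n$ for some $s\in S$. $d(u,v)$ denotes the directed distance (length of a shortest directed $uv$-path), and $\mathrm{diam}$ the maximum directed distance over ordered pairs of vertices. For nonnegative integers $i$ and positive $k$, $re(i,k)$ denotes the residue of $i$ modulo $k$ (in $\{0,\dots,k-1\}$). -}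

module Defs where

open import Data.Nat using (ℕ; zero; suc; _+_; _∸_; _≤_; _<_; _/_; _%_; NonZero)
open import Data.Fin using (Fin; toℕ)
open import Data.Product using (Σ; ∃; _×_; _,_)
open import Data.Sum using (_⊎_)
open import Relation.Binary.PropositionalEquality using (_≡_)

-- Arc relation of the circulant digraph C_n(S) on vertices Fin n (v_i ↦ i):
-- v_i → v_j iff j - i ≡ s (mod n) for some s ∈ S, i.e. (i + s) mod n = j.
Arc : (n : ℕ) .{{_ : NonZero n}} → (ℕ → Set) → Fin n → Fin n → Set
Arc n S u v = Σ ℕ λ s → S s × ((toℕ u + s) % n ≡ toℕ v)

data Walk (n : ℕ) .{{_ : NonZero n}} (S : ℕ → Set) : Fin n → Fin n → ℕ → Set where
  here : ∀ {u} → Walk n S u u 0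
  step : ∀ {u w v m} → Arc n S u w → Walk n S w v m → Walk n S u v (suc m)

IsDist : (n : ℕ) .{{_ : NonZero n}} → (ℕ → Set) → Fin n → Fin n → ℕ → Set
IsDist n S u v d = Walk n S u v d × (∀ m → Walk n S u v m → d ≤ m)

IsDiam : (n : ℕ) .{{_ : NonZero n}} → (ℕ → Set) → ℕ → Set
IsDiam n S D =
  (∀ u v → Σ ℕ λ d → IsDist n S u v d × d ≤ D) ×
  (Σ (Fin n) λ u → Σ (Fin n) λ v → IsDist n S u v D)

⌈_/_⌉ : ℕ → (b : ℕ) .{{_ : NonZero b}} → ℕ
⌈ a / b ⌉ = (a + (b ∸ 1)) / b

re : ℕ → (k : ℕ) .{{_ : NonZero k}} → ℕ
re i k = i % k

S1k : ℕ → ℕ → Set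
S1k k s = (s ≡ 1) ⊎ (s ≡ k)

-- A walk with a steps of length k and b steps of length 1 from v_u ends at v_w with
-- w ≡ u + ak + b (mod n), and each step raises cost x = ⌊x/k⌋ + re(x,k) of the
-- displacement x by at most one. Writing n + e = ck with c = ⌈n/k⌉, the hypothesis
-- (k-1)c ≤ n is exactly e ≤ c, and then cost y + c = cost (y + ck) ≤ cost (y + n) + e:
-- adding n never lowers the cost. So every walk is at least as long as the cost of the
-- least displacement (w - u) mod n, which the greedy walk attains. The diameter is the
-- largest cost on 0, …, n-1, reached at n-1 or at the last number below a multiple of k.
module Submission where

open import Defs
open import Data.Nat using (ℕ; zero; suc; _+_; _*_; _∸_; _≤_; _<_; _/_; _%_; _⊔_; NonZero; s≤s; s≤s⁻¹; >-nonZero⁻¹)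
open import Data.Nat.Properties
open import Data.Nat.DivMod
open import Data.Nat.Divisibility using (divides-refl)
open import Data.Nat.Tactic.RingSolver using (solve-∀)
open import Data.Fin using (Fin; toℕ; fromℕ<)
open import Data.Fin.Properties using (toℕ-fromℕ<; toℕ-injective; toℕ<n)
open import Data.Product using (Σ; _×_; _,_)
open import Data.Sum using (inj₁; inj₂)
open import Relation.Binary.PropositionalEquality
  using (_≡_; refl; sym; trans; cong; cong₂; subst; module ≡-Reasoning)

module DigitCost (k : ℕ) .{{_ : NonZero k}} where

  cost : ℕ → ℕ
  cost y = y / k + y % k

  cost[y+c*k]≡cost[y]+c : ∀ y c → cost (y + c * k) ≡ cost y + c
  cost[y+c*k]≡cost[y]+c y c = begin
    (y + c * k) / k + (y + c * k) % k
      ≡⟨ cong₂ _+_ (+-distrib-/-∣ʳ y (divides-refl c)) ([m+kn]%n≡m%n y c k) ⟩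
    y / k + c * k / k + y % k
      ≡⟨ cong (λ q → y / k + q + y % k) (m*n/n≡m c k) ⟩
    y / k + c + y % k
      ≡⟨ +-right-comm (y / k) c (y % k) ⟩
    cost y + c
      ∎
    where
      open ≡-Reasoning
      +-right-comm : ∀ q c r → q + c + r ≡ q + r + c
      +-right-comm = solve-∀

  cost[y]≤y : ∀ y → cost y ≤ y
  cost[y]≤y y = begin
    y / k + y % k     ≤⟨ +-monoˡ-≤ (y % k) (m≤m*n (y / k) k) ⟩
    y / k * k + y % k ≡⟨ +-comm (y / k * k) (y % k) ⟩
    y % k + y / k * k ≡⟨ m≡m%n+[m/n]*n y k ⟨
    y                 ∎
    where open ≤-Reasoning

  cost[x+e]≤cost[x]+e : ∀ x e → cost (x + e) ≤ cost x + e
  cost[x+e]≤cost[x]+e x e = begin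
    cost (x + e)                 ≡⟨ cong (λ z → cost (z + e)) (m≡m%n+[m/n]*n x k) ⟩
    cost (x % k + x / k * k + e) ≡⟨ cong cost (+-right-comm (x % k) (x / k * k) e) ⟩
    cost (x % k + e + x / k * k) ≡⟨ cost[y+c*k]≡cost[y]+c (x % k + e) (x / k) ⟩
    cost (x % k + e) + x / k     ≤⟨ +-monoˡ-≤ (x / k) (cost[y]≤y (x % k + e)) ⟩
    x % k + e + x / k            ≡⟨ rotate (x % k) e (x / k) ⟩
    cost x + e                   ∎
    where
      open ≤-Reasoning
      +-right-comm : ∀ r m e → r + m + e ≡ r + e + m
      +-right-comm = solve-∀
      rotate : ∀ r e q → r + e + q ≡ q + r + e
      rotate = solve-∀

  cost[r+q*k]≡q+r : ∀ r q → r < k → cost (r + q * k) ≡ q + r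
  cost[r+q*k]≡q+r r q r<k = begin
    cost (r + q * k)  ≡⟨ cost[y+c*k]≡cost[y]+c r q ⟩
    r / k + r % k + q ≡⟨ cong₂ (λ a b → a + b + q) (m<n⇒m/n≡0 r<k) (m<n⇒m%n≡m r<k) ⟩
    r + q             ≡⟨ +-comm r q ⟩
    q + r             ∎
    where open ≡-Reasoning

  module _ {n c e : ℕ} (n+e≡c*k : n + e ≡ c * k) (e≤c : e ≤ c) where

    cost[y]≤cost[y+n] : ∀ y → cost y ≤ cost (y + n)
    cost[y]≤cost[y+n] y = +-cancelʳ-≤ c (cost y) (cost (y + n)) (begin
      cost y + c           ≡⟨ cost[y+c*k]≡cost[y]+c y c ⟨
      cost (y + c * k)     ≡⟨ cong (λ z → cost (y + z)) n+e≡c*k ⟨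
      cost (y + (n + e))   ≡⟨ cong cost (+-assoc y n e) ⟨
      cost (y + n + e)     ≤⟨ cost[x+e]≤cost[x]+e (y + n) e ⟩
      cost (y + n) + e     ≤⟨ +-monoʳ-≤ (cost (y + n)) e≤c ⟩
      cost (y + n) + c     ∎)
      where open ≤-Reasoning

    cost[y]≤cost[y+t*n] : ∀ t y → cost y ≤ cost (y + t * n)
    cost[y]≤cost[y+t*n] zero y = ≤-reflexive (cong cost (sym (+-identityʳ y)))
    cost[y]≤cost[y+t*n] (suc t) y = begin
      cost y                 ≤⟨ cost[y]≤cost[y+t*n] t y ⟩
      cost (y + t * n)       ≤⟨ cost[y]≤cost[y+n] (y + t * n) ⟩
      cost (y + t * n + n)   ≡⟨ cong cost (+-assoc y (t * n) n) ⟩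
      cost (y + (t * n + n)) ≡⟨ cong (λ z → cost (y + z)) (+-comm (t * n) n) ⟩
      cost (y + suc t * n)   ∎
      where open ≤-Reasoning

  maxCost : ℕ → ℕ
  maxCost N = N / k + (N % k ⊔ (k ∸ 2))

  module _ (2≤k : 2 ≤ k) where

    cost≤maxCost : ∀ {j N} → j ≤ N → cost j ≤ maxCost N
    cost≤maxCost {j} {N} j≤N with m≤n⇒m<n∨m≡n (/-monoˡ-≤ k j≤N)
    ... | inj₁ j/k<N/k = begin
      j / k + j % k         ≤⟨ +-monoʳ-≤ (j / k) j%k≤1+[k∸2] ⟩
      j / k + suc (k ∸ 2)   ≡⟨ +-suc (j / k) (k ∸ 2) ⟩
      suc (j / k) + (k ∸ 2) ≤⟨ +-mono-≤ j/k<N/k (m≤n⊔m (N % k) (k ∸ 2)) ⟩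
      maxCost N             ∎
      where
        open ≤-Reasoning
        j%k≤1+[k∸2] : j % k ≤ suc (k ∸ 2)
        j%k≤1+[k∸2] = s≤s⁻¹ (subst (j % k <_) (sym (m+[n∸m]≡n 2≤k)) (m%n<n j k))
    ... | inj₂ j/k≡N/k = +-mono-≤ (≤-reflexive j/k≡N/k) (≤-trans j%k≤N%k (m≤m⊔n (N % k) (k ∸ 2)))
      where
        open ≤-Reasoning
        j%k≤N%k : j % k ≤ N % k
        j%k≤N%k = +-cancelʳ-≤ (N / k * k) (j % k) (N % k) (begin
          j % k + N / k * k ≡⟨ cong (λ q → j % k + q * k) j/k≡N/k ⟨
          j % k + j / k * k ≡⟨ m≡m%n+[m/n]*n j k ⟨
          j                 ≤⟨ j≤N ⟩
          N                 ≡⟨ m≡m%n+[m/n]*n N k ⟩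
          N % k + N / k * k ∎)

    maxCost-attained : ∀ {N} → k ≤ N → Σ ℕ λ j → j ≤ N × cost j ≡ maxCost N
    maxCost-attained {N} k≤N with ≤-total (k ∸ 2) (N % k)
    ... | inj₁ k∸2≤N%k = N , ≤-refl , cong (N / k +_) (sym (m≥n⇒m⊔n≡m k∸2≤N%k))
    ... | inj₂ N%k≤k∸2 = suc (k ∸ 2) + (N / k ∸ 1) * k , j≤N , (begin
      cost (suc (k ∸ 2) + (N / k ∸ 1) * k)
        ≡⟨ cost[r+q*k]≡q+r (suc (k ∸ 2)) (N / k ∸ 1) 1+[k∸2]<k ⟩
      (N / k ∸ 1) + suc (k ∸ 2)
        ≡⟨ +-suc (N / k ∸ 1) (k ∸ 2) ⟩
      suc (N / k ∸ 1) + (k ∸ 2)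
        ≡⟨ cong₂ _+_ 1+[N/k∸1]≡N/k (sym (m≤n⇒m⊔n≡n N%k≤k∸2)) ⟩
      maxCost N
        ∎)
      where
        open ≡-Reasoning
        1+[k∸2]<k : suc (k ∸ 2) < k
        1+[k∸2]<k = ≤-reflexive (m+[n∸m]≡n 2≤k)
        1+[N/k∸1]≡N/k : suc (N / k ∸ 1) ≡ N / k
        1+[N/k∸1]≡N/k = m+[n∸m]≡n (m≥n⇒m/n>0 k≤N)
        j≤N : suc (k ∸ 2) + (N / k ∸ 1) * k ≤ N
        j≤N = <⇒≤ (≤-trans (≤-reflexive (trans (cong (_+ (N / k ∸ 1) * k) (m+[n∸m]≡n 2≤k))
                                             (cong (_* k) 1+[N/k∸1]≡N/k)))
                           (m/n*n≤m N k))

[m%n+o]%n≡[m+o]%n : ∀ m o n .{{_ : NonZero n}} → (m % n + o) % n ≡ (m + o) % n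
[m%n+o]%n≡[m+o]%n m o n = begin
  (m % n + o) % n         ≡⟨ %-distribˡ-+ (m % n) o n ⟩
  (m % n % n + o % n) % n ≡⟨ cong (λ z → (z + o % n) % n) (m%n%n≡m%n m n) ⟩
  (m % n + o % n) % n     ≡⟨ %-distribˡ-+ m o n ⟨
  (m + o) % n             ∎
  where open ≡-Reasoning

module Circulant (n k : ℕ) .{{_ : NonZero n}} .{{_ : NonZero k}} where
  open DigitCost k

  Reaches : Fin n → ℕ → Fin n → Set
  Reaches u x v = (toℕ u + x) % n ≡ toℕ v

  shift : Fin n → ℕ → Fin n
  shift u s = fromℕ< (m%n<n (toℕ u + s) n)

  reaches-refl : ∀ u → Reaches u 0 u
  reaches-refl u = trans (cong (_% n) (+-identityʳ (toℕ u))) (m<n⇒m%n≡m (toℕ<n u))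

  reaches-0 : ∀ {u v} → Reaches u 0 v → u ≡ v
  reaches-0 {u} r = toℕ-injective (trans (sym (reaches-refl u)) r)

  reaches-+ : ∀ {u w v} s x → (toℕ u + s) % n ≡ toℕ w → Reaches w x v → Reaches u (s + x) v
  reaches-+ {u} {w} {v} s x arc r = begin
    (toℕ u + (s + x)) % n     ≡⟨ cong (_% n) (+-assoc (toℕ u) s x) ⟨
    (toℕ u + s + x) % n       ≡⟨ [m%n+o]%n≡[m+o]%n (toℕ u + s) x n ⟨
    ((toℕ u + s) % n + x) % n ≡⟨ cong (λ z → (z + x) % n) arc ⟩
    (toℕ w + x) % n           ≡⟨ r ⟩
    toℕ v                     ∎
    where open ≡-Reasoning

  reaches-shift : ∀ {u v} s x → Reaches u (s + x) v → Reaches (shift u s) x v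
  reaches-shift {u} {v} s x r = begin
    (toℕ (shift u s) + x) % n ≡⟨ cong (λ z → (z + x) % n) (toℕ-fromℕ< (m%n<n (toℕ u + s) n)) ⟩
    ((toℕ u + s) % n + x) % n ≡⟨ [m%n+o]%n≡[m+o]%n (toℕ u + s) x n ⟩
    (toℕ u + s + x) % n       ≡⟨ cong (_% n) (+-assoc (toℕ u) s x) ⟩
    (toℕ u + (s + x)) % n     ≡⟨ r ⟩
    toℕ v                     ∎
    where open ≡-Reasoning

  steps⇒walk : ∀ a b {u v} → Reaches u (a * k + b) v → Walk n (S1k k) u v (a + b)
  steps⇒walk zero zero r = subst (λ w → Walk n (S1k k) _ w 0) (reaches-0 r) here
  steps⇒walk zero (suc b) r =
    step (1 , inj₁ refl , sym (toℕ-fromℕ< _)) (steps⇒walk zero b (reaches-shift 1 b r))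
  steps⇒walk (suc a) b {u} {v} r =
    step (k , inj₂ refl , sym (toℕ-fromℕ< _)) (steps⇒walk a b (reaches-shift k (a * k + b) r′))
    where
      r′ : Reaches u (k + (a * k + b)) v
      r′ = subst (λ x → Reaches u x v) (+-assoc k (a * k) b) r

  walk⇒displacement : ∀ {u v m} → Walk n (S1k k) u v m → Σ ℕ λ x → Reaches u x v × cost x ≤ m
  walk⇒displacement {u} here = 0 , reaches-refl u , cost[y]≤y 0
  walk⇒displacement (step (_ , inj₁ refl , arc) w) with walk⇒displacement w
  ... | x , r , cost-x≤m = 1 + x , reaches-+ 1 x arc r , (begin
    cost (1 + x) ≡⟨ cong cost (+-comm 1 x) ⟩
    cost (x + 1) ≤⟨ cost[x+e]≤cost[x]+e x 1 ⟩
    cost x + 1   ≡⟨ +-comm (cost x) 1 ⟩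
    suc (cost x) ≤⟨ s≤s cost-x≤m ⟩
    suc _        ∎)
    where open ≤-Reasoning
  walk⇒displacement (step (_ , inj₂ refl , arc) w) with walk⇒displacement w
  ... | x , r , cost-x≤m = k + x , reaches-+ k x arc r , (begin
    cost (k + x)     ≡⟨ cong cost (trans (+-comm k x) (cong (x +_) (sym (*-identityˡ k)))) ⟩
    cost (x + 1 * k) ≡⟨ cost[y+c*k]≡cost[y]+c x 1 ⟩
    cost x + 1       ≡⟨ +-comm (cost x) 1 ⟩
    suc (cost x)     ≤⟨ s≤s cost-x≤m ⟩
    suc _            ∎)
    where open ≤-Reasoning

  offset : Fin n → Fin n → ℕ
  offset u v = (toℕ v + (n ∸ toℕ u)) % n

  reaches-offset : ∀ u v → Reaches u (offset u v) v
  reaches-offset u v = begin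
    (toℕ u + offset u v) % n            ≡⟨ cong (_% n) (+-comm (toℕ u) (offset u v)) ⟩
    (offset u v + toℕ u) % n            ≡⟨ [m%n+o]%n≡[m+o]%n (toℕ v + (n ∸ toℕ u)) (toℕ u) n ⟩
    (toℕ v + (n ∸ toℕ u) + toℕ u) % n   ≡⟨ cong (_% n) (+-assoc (toℕ v) (n ∸ toℕ u) (toℕ u)) ⟩
    (toℕ v + (n ∸ toℕ u + toℕ u)) % n   ≡⟨ cong (λ z → (toℕ v + z) % n) (m∸n+n≡m (<⇒≤ (toℕ<n u))) ⟩
    (toℕ v + n) % n                     ≡⟨ [m+n]%n≡m%n (toℕ v) n ⟩
    toℕ v % n                           ≡⟨ m<n⇒m%n≡m (toℕ<n v) ⟩
    toℕ v                               ∎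
    where open ≡-Reasoning

  reaches⇒offset : ∀ {u v} x → Reaches u x v → x % n ≡ offset u v
  reaches⇒offset {u} {v} x r = begin
    x % n                               ≡⟨ [m+n]%n≡m%n x n ⟨
    (x + n) % n                         ≡⟨ cong (λ z → (x + z) % n) (m+[n∸m]≡n (<⇒≤ (toℕ<n u))) ⟨
    (x + (toℕ u + (n ∸ toℕ u))) % n     ≡⟨ cong (_% n) (rearrange x (toℕ u) (n ∸ toℕ u)) ⟩
    (toℕ u + x + (n ∸ toℕ u)) % n       ≡⟨ [m%n+o]%n≡[m+o]%n (toℕ u + x) (n ∸ toℕ u) n ⟨
    ((toℕ u + x) % n + (n ∸ toℕ u)) % n ≡⟨ cong (λ z → (z + (n ∸ toℕ u)) % n) r ⟩
    offset u v                          ∎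
    where
      open ≡-Reasoning
      rearrange : ∀ x u w → x + (u + w) ≡ u + x + w
      rearrange = solve-∀

  offset-from-zero : ∀ {u} v → toℕ u ≡ 0 → offset u v ≡ toℕ v
  offset-from-zero {u} v u≡0 = begin
    (toℕ v + (n ∸ toℕ u)) % n ≡⟨ cong (λ z → (toℕ v + (n ∸ z)) % n) u≡0 ⟩
    (toℕ v + n) % n           ≡⟨ [m+n]%n≡m%n (toℕ v) n ⟩
    toℕ v % n                 ≡⟨ m<n⇒m%n≡m (toℕ<n v) ⟩
    toℕ v                     ∎
    where open ≡-Reasoning

  module _ {c e : ℕ} (n+e≡c*k : n + e ≡ c * k) (e≤c : e ≤ c) where

    isDist-offset : ∀ u v → IsDist n (S1k k) u v (cost (offset u v))
    isDist-offset u v = steps⇒walk (i / k) (i % k) i-reaches , shortest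
      where
        i = offset u v
        i-reaches : Reaches u (i / k * k + i % k) v
        i-reaches = subst (λ x → Reaches u x v)
                          (trans (m≡m%n+[m/n]*n i k) (+-comm (i % k) (i / k * k)))
                          (reaches-offset u v)
        shortest : ∀ m → Walk n (S1k k) u v m → cost i ≤ m
        shortest m w with walk⇒displacement w
        ... | x , r , cost-x≤m = begin
          cost i                   ≤⟨ cost[y]≤cost[y+t*n] n+e≡c*k e≤c (x / n) i ⟩
          cost (i + x / n * n)     ≡⟨ cong (λ z → cost (z + x / n * n)) (reaches⇒offset x r) ⟨
          cost (x % n + x / n * n) ≡⟨ cong cost (m≡m%n+[m/n]*n x n) ⟨
          cost x                   ≤⟨ cost-x≤m ⟩
          m                        ∎
          where open ≤-Reasoning

    isDiam : 2 ≤ k → k ≤ n ∸ 1 → IsDiam n (S1k k) (maxCost (n ∸ 1))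
    isDiam 2≤k k≤n∸1 =
      (λ u v → cost (offset u v) , isDist-offset u v , cost≤maxCost 2≤k (offset≤n∸1 u v)) ,
      farthest
      where
        offset≤n∸1 : ∀ u v → offset u v ≤ n ∸ 1
        offset≤n∸1 u v = subst (offset u v ≤_) (pred[m∸n]≡m∸[1+n] n 0) (<⇒≤pred (m%n<n _ n))
        farthest : Σ (Fin n) λ u → Σ (Fin n) λ v → IsDist n (S1k k) u v (maxCost (n ∸ 1))
        farthest with maxCost-attained 2≤k k≤n∸1
        ... | j , j≤n∸1 , cost-j≡max = v₀ , v , subst (IsDist n (S1k k) v₀ v) cost≡max (isDist-offset v₀ v)
          where
            j<n : j < n
            j<n = m≤pred[n]⇒suc[m]≤n (subst (j ≤_) (sym (pred[m∸n]≡m∸[1+n] n 0)) j≤n∸1)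
            v₀ v : Fin n
            v₀ = fromℕ< (>-nonZero⁻¹ n)
            v = fromℕ< j<n
            offset≡j : offset v₀ v ≡ j
            offset≡j = trans (offset-from-zero v (toℕ-fromℕ< (>-nonZero⁻¹ n))) (toℕ-fromℕ< j<n)
            cost≡max : cost (offset v₀ v) ≡ maxCost (n ∸ 1)
            cost≡max = trans (cong cost offset≡j) cost-j≡max

⌈/⌉-padding : ∀ m k .{{_ : NonZero k}} → (k ∸ 1) * ⌈ m / k ⌉ ≤ m →
              Σ ℕ λ e → m + e ≡ ⌈ m / k ⌉ * k × e ≤ ⌈ m / k ⌉
⌈/⌉-padding m k hyp = k ∸ 1 ∸ ρ , m+e≡c*k , e≤c
  where
    c = ⌈ m / k ⌉
    ρ = (m + (k ∸ 1)) % k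
    ρ≤k∸1 : ρ ≤ k ∸ 1
    ρ≤k∸1 = subst (ρ ≤_) (pred[m∸n]≡m∸[1+n] k 0) (<⇒≤pred (m%n<n _ k))
    m+e≡c*k : m + (k ∸ 1 ∸ ρ) ≡ c * k
    m+e≡c*k = +-cancelʳ-≡ ρ (m + (k ∸ 1 ∸ ρ)) (c * k) (begin
      m + (k ∸ 1 ∸ ρ) + ρ   ≡⟨ +-assoc m (k ∸ 1 ∸ ρ) ρ ⟩
      m + (k ∸ 1 ∸ ρ + ρ)   ≡⟨ cong (m +_) (m∸n+n≡m ρ≤k∸1) ⟩
      m + (k ∸ 1)           ≡⟨ m≡m%n+[m/n]*n (m + (k ∸ 1)) k ⟩
      ρ + c * k             ≡⟨ +-comm ρ (c * k) ⟩
      c * k + ρ             ∎)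
      where open ≡-Reasoning
    e≤c : k ∸ 1 ∸ ρ ≤ c
    e≤c = +-cancelˡ-≤ m (k ∸ 1 ∸ ρ) c (begin
      m + (k ∸ 1 ∸ ρ)       ≡⟨ m+e≡c*k ⟩
      c * k                 ≡⟨ cong (c *_) (m+[n∸m]≡n (>-nonZero⁻¹ k)) ⟨
      c * (1 + (k ∸ 1))     ≡⟨ distrib c (k ∸ 1) ⟩
      c + (k ∸ 1) * c       ≤⟨ +-monoʳ-≤ c hyp ⟩
      c + m                 ≡⟨ +-comm c m ⟩
      m + c                 ∎)
      where
        open ≤-Reasoning
        distrib : ∀ c j → c * (1 + j) ≡ c + j * c
        distrib = solve-∀

lemma8 : (n k : ℕ) .{{nzk : NonZero k}} .{{nzn : NonZero n}} →
    2 ≤ k → k ≤ n ∸ 1 → (k ∸ 1) * ⌈ n / k ⌉ ≤ n →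
    ((u i : Fin n) → toℕ u ≡ 0 →
      IsDist n (S1k k) u i (toℕ i / k + re (toℕ i) k))
    × IsDiam n (S1k k) ((n ∸ 1) / k + (re (n ∸ 1) k ⊔ (k ∸ 2)))
lemma8 n k 2≤k k≤n∸1 ceil-hyp with ⌈/⌉-padding n k ceil-hyp
... | e , n+e≡c*k , e≤c = distance-from-v₀ , isDiam n+e≡c*k e≤c 2≤k k≤n∸1
  where
    open Circulant n k
    open DigitCost k using (cost)
    distance-from-v₀ : (u i : Fin n) → toℕ u ≡ 0 → IsDist n (S1k k) u i (cost (toℕ i))
    distance-from-v₀ u i u≡0 =
      subst (IsDist n (S1k k) u i) (cong cost (offset-from-zero i u≡0)) (isDist-offset n+e≡c*k e≤c u i)
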